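{- Fix an instance of lower-bounded $k$-supplier with outliers and $\tau\ge0$, and let $F\subseteq\mathcal F_\tau$ be a pre-skeleton in $G_\tau$. Let $U=\{i\in\mathcal F_\tau:\mathrm{dist}_\tau(i,F)\ge 6\}$ and let $i\in U$ satisfy $|N(i)|=\max_{i'\in U}|N(i')|$. Then either $F$ is a skeleton, or $F\cup\{i\}$ is a pre-skeleton.
   Context: Instance: facilities $\mathcal F$, clients $\mathcal D$ in a metric space with distances $c$, lower bounds $L_i$, integers $k,m$. For $\tau\ge0$ let $B(i,\tau)=\{j\in\mathcal D:c(i,j)\le\tau\}$, $\mathcal F_\tau=\{i\in\mathcal F:|B(i,\tau)|\ge L_i\}$, and $G_\tau$ the bipartite graph on $\mathcal D\cup\mathcal F_\tau$ with an edge $ij$ ($i\in\mathcal F_\tau$, $j\in\mathcal D$) iff $c(i,j)\le\tau$. $\mathrm{dist}_\tau$ is the shortest-path distance in $G_\tau$ ($\infty$ if disconnected), $\mathrm{dist}_\tau(v,F)=\min_{i\in F}\mathrm{dist}_\tau(v,i)$ ($=\infty$ if $F=\emptyset$), and $N(v)$ is the neighbour set of $v$ in $G_\tau$. A feasible distance-1 assignment is a map $\sigma^*:\mathcal D\to F^*\cup\{\mathsf{out}\}$ with $F^*\subseteq\mathcal F_\tau$, $|F^*|\le k$, $|\sigma^{*-1}(i)|\ge L_i$ for all $i\in F^*$, $|\sigma^{*-1}(\mathsf{out})|\le m$, and $\mathrm{dist}_\tau(j,\sigma^*(j))\le1$ whenever $\sigma^*(j)\ne\mathsf{out}$. A set $F\subseteq\mathcal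 F_\tau$ has the separation property if $\mathrm{dist}_\tau(i,i')\ge6$ for all distinct $i,i'\in F$. Relative to a feasible distance-1 assignment $\sigma^*:\mathcal D\to F^*\cup\{\mathsf{out}\}$, $F$ has the covering property if $\mathrm{dist}_\tau(i^*,F)\le4$ for all $i^*\in F^*$, and the injection property if there is a map $f:F\to F^*$ with $\mathrm{dist}_\tau(i,f(i))\le2$ for all $i\in F$. $F$ is a pre-skeleton if it has the separation property and there is a feasible distance-1 assignment relative to which it has the injection property; $F$ is a skeleton if it has the separation property and there is a feasible distance-1 assignment relative to which it has both the covering and injection properties.
   Formalization: The distances $c$ of the metric space and the threshold $\tau$ take rational values. -}

module Defs where

open import Data.Nat using (ℕ; zero; suc; _≤_; _<_)
open import Data.Fin using (Fin)
open import Data.Fin.Subset using (Subset; _∈_; ∣_∣)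
open import Data.Fin.Properties using () renaming (_≟_ to _≟ᶠ_)
open import Data.List using (List; length; filter)
open import Data.List.Base using ()
open import Data.Fin.Base using ()
open import Data.Vec.Functional using ()
open import Data.Maybe using (Maybe; just; nothing)
open import Data.Maybe.Properties using (≡-dec)
open import Data.Product using (Σ; ∃; _×_; _,_)
open import Data.Sum using (_⊎_; inj₁; inj₂)
open import Data.Rational using (ℚ; 0ℚ; _+_) renaming (_≤_ to _≤ℚ_; _≤?_ to _≤ℚ?_)
open import Relation.Binary.PropositionalEquality using (_≡_)
open import Relation.Nullary using (¬_; Dec)
open import Relation.Nullary.Decidable using (_×-dec_)
open import Data.List using (allFin)

-- Points of the metric space: facilities (Fin nF) and clients (Fin nD).
Pt : ℕ → ℕ → Set
Pt nF nD = Fin nF ⊎ Fin nD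

-- A (pseudo)metric with rational values (the paper's distances are reals).
record IsMetric {A : Set} (d : A → A → ℚ) : Set where
  field
    nonneg : ∀ x y → 0ℚ ≤ℚ d x y
    self   : ∀ x → d x x ≡ 0ℚ
    symm   : ∀ x y → d x y ≡ d y x
    tri    : ∀ x y z → d x z ≤ℚ (d x y + d y z)

record Instance : Set where
  field
    nF nD : ℕ
    d     : Pt nF nD → Pt nF nD → ℚ
    metric : IsMetric d
    L     : Fin nF → ℕ
    k m   : ℕ

module _ (I : Instance) (τ : ℚ) where
  open Instance I

  c : Fin nF → Fin nD → ℚ
  c i j = d (inj₁ i) (inj₂ j)

  countD : {P : Fin nD → Set} → ((j : Fin nD) → Dec (P j)) → ℕ
  countD P? = length (filter P? (allFin nD))

  ballSize : Fin nF → ℕ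
  ballSize i = countD (λ j → c i j ≤ℚ? τ)

  InFτ : Fin nF → Set
  InFτ i = L i ≤ ballSize i

  inFτ? : (i : Fin nF) → Dec (InFτ i)
  inFτ? i = Data.Nat._≤?_ (L i) (ballSize i)

  -- vertices of G_τ: clients and facilities (facilities outside F_τ are isolated)
  V : Set
  V = Pt nF nD

  Edge : V → V → Set
  Edge (inj₁ i) (inj₂ j) = InFτ i × c i j ≤ℚ τ
  Edge (inj₂ j) (inj₁ i) = InFτ i × c i j ≤ℚ τ
  Edge _ _ = Data.Empty.⊥
    where import Data.Empty

  data Walk : V → V → ℕ → Set where
    here : ∀ {u} → Walk u u zero
    step : ∀ {u v w n} → Edge u v → Walk v w n → Walk u w (suc n)

  -- dist_τ(u,v) ≤ n  (shortest-path distance; ∞ if no walk)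
  DistLe : ℕ → V → V → Set
  DistLe n u v = ∃ λ l → l ≤ n × Walk u v l

  -- dist_τ(u,F) ≤ n   (false when F = ∅, as dist = ∞)
  DistSetLe : ℕ → V → Subset nF → Set
  DistSetLe n u F = ∃ λ i → i ∈ F × DistLe n u (inj₁ i)

  DistGe : ℕ → V → V → Set
  DistGe zero u v = Data.Unit.⊤
    where import Data.Unit
  DistGe (suc n) u v = ¬ DistLe n u v

  DistSetGe : ℕ → V → Subset nF → Set
  DistSetGe zero u F = Data.Unit.⊤
    where import Data.Unit
  DistSetGe (suc n) u F = ¬ DistSetLe n u F

  degF : Fin nF → ℕ
  degF i = countD (λ j → inFτ? i ×-dec (c i j ≤ℚ? τ))

  SubFτ : Subset nF → Set
  SubFτ F = ∀ i → i ∈ F → InFτ i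

  -- assignments σ : D → F* ∪ {out}; nothing = out
  Assignment : Set
  Assignment = Fin nD → Maybe (Fin nF)

  preimageSize : Assignment → Maybe (Fin nF) → ℕ
  preimageSize σ x = countD (λ j → ≡-dec _≟ᶠ_ (σ j) x)

  record Feasible (Fs : Subset nF) (σ : Assignment) : Set where
    field
      sub      : SubFτ Fs
      card     : ∣ Fs ∣ ≤ k
      range    : ∀ j i → σ j ≡ just i → i ∈ Fs
      lower    : ∀ i → i ∈ Fs → L i ≤ preimageSize σ (just i)
      outliers : preimageSize σ nothing ≤ m
      near     : ∀ j i → σ j ≡ just i → DistLe 1 (inj₂ j) (inj₁ i)

  Separation : Subset nF → Set
  Separation F = SubFτ F × (∀ i i' → i ∈ F → i' ∈ F → ¬ i ≡ i' → DistGe 6 (inj₁ i) (inj₁ i'))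

  Covering : Subset nF → Subset nF → Set
  Covering F Fs = ∀ i → i ∈ Fs → DistSetLe 4 (inj₁ i) F

  Injection : Subset nF → Subset nF → Set
  Injection F Fs = (i : Fin nF) → i ∈ F → Σ (Fin nF) λ i* → i* ∈ Fs × DistLe 2 (inj₁ i) (inj₁ i*)

  PreSkeleton : Subset nF → Set
  PreSkeleton F = Separation F ×
    (∃ λ Fs → ∃ λ σ → Feasible Fs σ × Injection F Fs)

  Skeleton : Subset nF → Set
  Skeleton F = Separation F ×
    (∃ λ Fs → ∃ λ σ → Feasible Fs σ × Covering F Fs × Injection F Fs)

  InU : Subset nF → Fin nF → Set
  InU F i = InFτ i × DistSetGe 6 (inj₁ i) F

{-# OPTIONS --safe #-}
-- Let σ* : 𝒟 → F* ∪ {out} witness that F is a pre-skeleton. If F covers F*, then F is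
-- a skeleton. Otherwise some i⁻ ∈ F* has dist(i⁻, F) > 4, hence ≥ 6 because G_τ is
-- bipartite; so i⁻ ∈ U and |N(i⁻)| ≤ |N(i)|. As i ∈ U, F ∪ {i} stays 6-separated, and
-- only the injection must be extended to i. If σ* assigns some neighbour j of i, send
-- i to σ*(j), at distance ≤ 2. Otherwise all of N(i) are outliers: replace i⁻ by i in
-- F*, assign N(i) to i and make the other clients of i⁻ outliers. This frees |N(i)|
-- outliers and creates at most |N(i⁻)| ≤ |N(i)| new ones, and no point of F was sent
-- to i⁻, which lies farther than 2 from F.
module Submission where

open import Defs
open import Data.Nat using (zero; suc; _+_; _≤_; z≤n; s≤s; s≤s⁻¹; parity)
open import Data.Nat.Properties
  using (≤-refl; ≤-trans; ≤-reflexive; n≤1+n; +-suc; +-comm; +-mono-≤; +-monoʳ-≤;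
         m≤n⇒m<n∨m≡n; anyUpTo?; module ≤-Reasoning)
open import Data.Parity.Base using (0ℙ; 1ℙ)
open import Data.Rational using (ℚ; 0ℚ) renaming (_≤_ to _≤ℚ_; _≤?_ to _≤ℚ?_)
open import Data.Fin using (Fin)
open import Data.Fin.Properties using (any?) renaming (_≟_ to _≟ᶠ_)
open import Data.Fin.Subset using (Subset; _∈_; _∉_; _⊆_; _∪_; _─_; _-_; ⁅_⁆; ∣_∣; inside; outside)
open import Data.Fin.Subset.Properties
  using (_∈?_; p⊆p∪q; x∈p∪q⁻; x∈p∪q⁺; x∈⁅x⁆; x∈⁅y⁆⇒x≡y; ∣⁅x⁆∣≡1; p─q⊆p;
         x∈p∧x≢y⇒x∈p-y; x∈p⇒∣p-x∣<∣p∣)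
open import Data.Vec using ([]; _∷_; here; there)
open import Data.List using ([]; _∷_; length; filter; allFin)
open import Data.List.Relation.Binary.Sublist.Propositional using (⊆-refl)
open import Data.List.Relation.Binary.Sublist.Propositional.Properties
  using (filter⁺; length-mono-≤)
open import Data.Maybe using (Maybe; just; nothing)
open import Data.Maybe.Properties using () renaming (≡-dec to ≡-decᴹ)
open import Data.Sum using (_⊎_; inj₁; inj₂; [_,_]′; map₂)
open import Data.Sum.Properties using () renaming (≡-dec to ≡-dec⊎)
open import Data.Product using (∃; ∃₂; _×_; _,_; proj₁; proj₂)
open import Function using (_∘_)
open import Relation.Binary.PropositionalEquality using (_≡_; _≢_; refl; sym; trans; cong; subst)
open import Relation.Nullary using (¬_; Dec; yes; no; ¬?; contradiction)
open import Relation.Nullary.Decidable using (map′; _×-dec_; _⊎-dec_; decidable-stable)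
import Relation.Unary as U
open import Relation.Unary.Properties using (_∩?_; ∁?)

module _ {a} {A : Set a} where

  length-filter-mono : ∀ {p q} {P : U.Pred A p} {Q : U.Pred A q}
    (P? : U.Decidable P) (Q? : U.Decidable Q) → P U.⊆ Q → ∀ xs →
    length (filter P? xs) ≤ length (filter Q? xs)
  length-filter-mono P? Q? P⊆Q xs =
    length-mono-≤ (filter⁺ P? Q? (λ { refl → P⊆Q }) (⊆-refl {x = xs}))

  length-filter-split : ∀ {p q} {P : U.Pred A p} {Q : U.Pred A q}
    (P? : U.Decidable P) (Q? : U.Decidable Q) → ∀ xs →
    length (filter P? xs) ≡ length (filter (P? ∩? Q?) xs) + length (filter (P? ∩? ∁? Q?) xs)
  length-filter-split P? Q? [] = refl
  length-filter-split P? Q? (x ∷ xs) with P? x | Q? x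
  ... | yes _ | yes _ = cong suc (length-filter-split P? Q? xs)
  ... | yes _ | no _  = trans (cong suc (length-filter-split P? Q? xs)) (sym (+-suc _ _))
  ... | no _  | _     = length-filter-split P? Q? xs

  length-filter-⊆∪ : ∀ {p q r} {P : U.Pred A p} {Q : U.Pred A q} {R : U.Pred A r}
    (P? : U.Decidable P) (Q? : U.Decidable Q) (R? : U.Decidable R) → P U.⊆ Q U.∪ R → ∀ xs →
    length (filter P? xs) ≤ length (filter Q? xs) + length (filter R? xs)
  length-filter-⊆∪ {P = P} {Q} {R} P? Q? R? P⊆Q∪R xs = begin
    length (filter P? xs)
      ≡⟨ length-filter-split P? Q? xs ⟩
    length (filter (P? ∩? Q?) xs) + length (filter (P? ∩? ∁? Q?) xs)
      ≤⟨ +-mono-≤ (length-filter-mono (P? ∩? Q?) Q? proj₂ xs)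
                  (length-filter-mono (P? ∩? ∁? Q?) R? outsideQ xs) ⟩
    length (filter Q? xs) + length (filter R? xs) ∎
    where
    open ≤-Reasoning
    outsideQ : P U.∩ U.∁ Q U.⊆ R
    outsideQ (p , ¬q) with P⊆Q∪R p
    ... | inj₁ q = contradiction q ¬q
    ... | inj₂ r = r

x∈p─q⇒x∉q : ∀ {n} {x : Fin n} (p q : Subset n) → x ∈ p ─ q → x ∉ q
x∈p─q⇒x∉q (_ ∷ p) (outside ∷ q) here ()
x∈p─q⇒x∉q (_ ∷ p) (_ ∷ q) (there x∈p─q) (there x∈q) = x∈p─q⇒x∉q p q x∈p─q x∈q

x∈p-y⇒x≢y : ∀ {n} {x y : Fin n} (p : Subset n) → x ∈ p - y → x ≢ y
x∈p-y⇒x≢y {y = y} p x∈p-y refl = x∈p─q⇒x∉q p ⁅ y ⁆ x∈p-y (x∈⁅x⁆ y)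

∣p∪q∣≤∣p∣+∣q∣ : ∀ {n} (p q : Subset n) → ∣ p ∪ q ∣ ≤ ∣ p ∣ + ∣ q ∣
∣p∪q∣≤∣p∣+∣q∣ [] [] = z≤n
∣p∪q∣≤∣p∣+∣q∣ (inside ∷ p) (inside ∷ q) =
  s≤s (≤-trans (∣p∪q∣≤∣p∣+∣q∣ p q) (+-monoʳ-≤ ∣ p ∣ (n≤1+n ∣ q ∣)))
∣p∪q∣≤∣p∣+∣q∣ (inside ∷ p) (outside ∷ q) = s≤s (∣p∪q∣≤∣p∣+∣q∣ p q)
∣p∪q∣≤∣p∣+∣q∣ (outside ∷ p) (inside ∷ q) =
  ≤-trans (s≤s (∣p∪q∣≤∣p∣+∣q∣ p q)) (≤-reflexive (sym (+-suc ∣ p ∣ ∣ q ∣)))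
∣p∪q∣≤∣p∣+∣q∣ (outside ∷ p) (outside ∷ q) = ∣p∪q∣≤∣p∣+∣q∣ p q

x∈p∪⁅y⁆⁻ : ∀ {n} {x y : Fin n} (p : Subset n) → x ∈ p ∪ ⁅ y ⁆ → x ∈ p ⊎ x ≡ y
x∈p∪⁅y⁆⁻ {y = y} p x∈p∪⁅y⁆ = map₂ (x∈⁅y⁆⇒x≡y y) (x∈p∪q⁻ p ⁅ y ⁆ x∈p∪⁅y⁆)

≢nothing⇒just : ∀ {A : Set} {m : Maybe A} → m ≢ nothing → ∃ λ y → m ≡ just y
≢nothing⇒just {m = nothing} m≢nothing = contradiction refl m≢nothing
≢nothing⇒just {m = just y}  _         = y , refl

module Graph (I : Instance) (τ : ℚ) where
  open Instance I

  neighbour? : (i : Fin nF) → U.Decidable (λ j → Edge I τ (inj₁ i) (inj₂ j))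
  neighbour? i j = inFτ? I τ i ×-dec (c I τ i j ≤ℚ? τ)

  edge? : (u v : V I τ) → Dec (Edge I τ u v)
  edge? (inj₁ i) (inj₂ j) = neighbour? i j
  edge? (inj₂ j) (inj₁ i) = neighbour? i j
  edge? (inj₁ _) (inj₁ _) = no λ ()
  edge? (inj₂ _) (inj₂ _) = no λ ()

  Edge-sym : ∀ {u v} → Edge I τ u v → Edge I τ v u
  Edge-sym {inj₁ _} {inj₂ _} e = e
  Edge-sym {inj₂ _} {inj₁ _} e = e

  _++ʷ_ : ∀ {u v w a b} → Walk I τ u v a → Walk I τ v w b → Walk I τ u w (a + b)
  here     ++ʷ q = q
  step e p ++ʷ q = step e (p ++ʷ q)

  reverseʷ : ∀ {u v l} → Walk I τ u v l → Walk I τ v u l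
  reverseʷ here = here
  reverseʷ (step {n = l} e p) =
    subst (Walk I τ _ _) (+-comm l 1) (reverseʷ p ++ʷ step (Edge-sym e) here)

  DistLe-refl : ∀ {n u} → DistLe I τ n u u
  DistLe-refl = 0 , z≤n , here

  Edge⇒DistLe : ∀ {u v} → Edge I τ u v → DistLe I τ 1 u v
  Edge⇒DistLe e = 1 , ≤-refl , step e here

  DistLe-sym : ∀ {n u v} → DistLe I τ n u v → DistLe I τ n v u
  DistLe-sym (l , l≤n , p) = l , l≤n , reverseʷ p

  DistLe-mono : ∀ {m n u v} → m ≤ n → DistLe I τ m u v → DistLe I τ n u v
  DistLe-mono m≤n (l , l≤m , p) = l , ≤-trans l≤m m≤n , p

  DistLe-trans : ∀ {m n u v w} → DistLe I τ m u v → DistLe I τ n v w → DistLe I τ (m + n) u w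
  DistLe-trans (l , l≤m , p) (l′ , l′≤n , q) = l + l′ , +-mono-≤ l≤m l′≤n , p ++ʷ q

  DistSetLe-mono : ∀ {m n u F} → m ≤ n → DistSetLe I τ m u F → DistSetLe I τ n u F
  DistSetLe-mono m≤n (x , x∈F , d) = x , x∈F , DistLe-mono m≤n d

  DistLe1⇒Edge : ∀ {i j} → DistLe I τ 1 (inj₂ j) (inj₁ i) → Edge I τ (inj₁ i) (inj₂ j)
  DistLe1⇒Edge (1 , _ , step e here) = e
  DistLe1⇒Edge (0 , _ , ())
  DistLe1⇒Edge (suc (suc _) , s≤s () , _)

  facility-walk-even : ∀ {a b l} → Walk I τ (inj₁ a) (inj₁ b) l → parity l ≡ 0ℙ
  facility-walk-even here = refl
  facility-walk-even (step {v = inj₂ _} _ (step {v = inj₁ _} _ p)) = facility-walk-even p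

  facility-DistLe-odd : ∀ {n a b} → parity (suc n) ≡ 1ℙ →
    DistLe I τ (suc n) (inj₁ a) (inj₁ b) → DistLe I τ n (inj₁ a) (inj₁ b)
  facility-DistLe-odd odd (l , l≤1+n , p) with m≤n⇒m<n∨m≡n l≤1+n
  ... | inj₁ l<1+n = l , s≤s⁻¹ l<1+n , p
  ... | inj₂ refl with () ← trans (sym odd) (facility-walk-even p)

  _≟ᵛ_ : (u v : V I τ) → Dec (u ≡ v)
  _≟ᵛ_ = ≡-dec⊎ _≟ᶠ_ _≟ᶠ_

  anyᵛ? : ∀ {p} {P : U.Pred (V I τ) p} → U.Decidable P → Dec (∃ P)
  anyᵛ? P? = map′ [ (λ (i , p) → inj₁ i , p) , (λ (j , p) → inj₂ j , p) ]′
                  (λ { (inj₁ i , p) → inj₁ (i , p) ; (inj₂ j , p) → inj₂ (j , p) })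
                  (any? (P? ∘ inj₁) ⊎-dec any? (P? ∘ inj₂))

  walk? : ∀ l u v → Dec (Walk I τ u v l)
  walk? zero    u v = map′ (λ { refl → here }) (λ { here → refl }) (u ≟ᵛ v)
  walk? (suc l) u v = map′ (λ (w , e , p) → step e p) (λ { (step e p) → _ , e , p })
                           (anyᵛ? (λ w → edge? u w ×-dec walk? l w v))

  DistLe? : ∀ n u v → Dec (DistLe I τ n u v)
  DistLe? n u v = map′ (λ (l , l<1+n , p) → l , s≤s⁻¹ l<1+n , p)
                       (λ (l , l≤n , p) → l , s≤s l≤n , p)
                       (anyUpTo? (λ l → walk? l u v) (suc n))

  DistSetLe? : ∀ n u F → Dec (DistSetLe I τ n u F)
  DistSetLe? n u F = any? (λ x → (x ∈? F) ×-dec DistLe? n u (inj₁ x))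

module _ (I : Instance) (τ : ℚ) where
  open Instance I
  open Graph I τ

  Separation-∪⁅⁆ : ∀ {F i} → Separation I τ F → InU I τ F i → Separation I τ (F ∪ ⁅ i ⁆)
  Separation-∪⁅⁆ {F} {i} (F⊆Fτ , F-sep) (i∈Fτ , i-far) = F∪⁅i⁆⊆Fτ , F∪⁅i⁆-sep
    where
    F∪⁅i⁆⊆Fτ : SubFτ I τ (F ∪ ⁅ i ⁆)
    F∪⁅i⁆⊆Fτ x x∈ with x∈p∪⁅y⁆⁻ F x∈
    ... | inj₁ x∈F = F⊆Fτ x x∈F
    ... | inj₂ refl = i∈Fτ
    F∪⁅i⁆-sep : ∀ x x′ → x ∈ F ∪ ⁅ i ⁆ → x′ ∈ F ∪ ⁅ i ⁆ → x ≢ x′ → DistGe I τ 6 (inj₁ x) (inj₁ x′)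
    F∪⁅i⁆-sep x x′ x∈ x′∈ x≢x′ with x∈p∪⁅y⁆⁻ F x∈ | x∈p∪⁅y⁆⁻ F x′∈
    ... | inj₁ x∈F  | inj₁ x′∈F = F-sep x x′ x∈F x′∈F x≢x′
    ... | inj₁ x∈F  | inj₂ refl = λ d → i-far (x , x∈F , DistLe-sym d)
    ... | inj₂ refl | inj₁ x′∈F = λ d → i-far (x′ , x′∈F , d)
    ... | inj₂ refl | inj₂ refl = contradiction refl x≢x′

  Injection-∪⁅⁆ : ∀ {F Fs i i*} → Injection I τ F Fs → i* ∈ Fs → DistLe I τ 2 (inj₁ i) (inj₁ i*) →
    Injection I τ (F ∪ ⁅ i ⁆) Fs
  Injection-∪⁅⁆ {F} f i*∈Fs d x x∈ with x∈p∪⁅y⁆⁻ F x∈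
  ... | inj₁ x∈F = f x x∈F
  ... | inj₂ refl = _ , i*∈Fs , d

  Injection-⊆ : ∀ {F Fs Fs′} → Fs ⊆ Fs′ → Injection I τ F Fs → Injection I τ F Fs′
  Injection-⊆ Fs⊆Fs′ f x x∈F with f x x∈F
  ... | y , y∈Fs , d = y , Fs⊆Fs′ y∈Fs , d

  Injection-─ : ∀ {F Fs i⁻} → Injection I τ F Fs → ¬ DistSetLe I τ 2 (inj₁ i⁻) F →
    Injection I τ F (Fs - i⁻)
  Injection-─ f far x x∈F with f x x∈F
  ... | y , y∈Fs , d = y , x∈p∧x≢y⇒x∈p-y y∈Fs (λ { refl → far (x , x∈F , DistLe-sym d) }) , d

  Injection-∪-assigned-neighbour : ∀ {F Fs σ i j y} → Feasible I τ Fs σ → Injection I τ F Fs →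
    Edge I τ (inj₁ i) (inj₂ j) → σ j ≡ just y → Injection I τ (F ∪ ⁅ i ⁆) Fs
  Injection-∪-assigned-neighbour {j = j} {y} feasible f e σj≡y =
    Injection-∪⁅⁆ f (range j y σj≡y) (DistLe-trans (Edge⇒DistLe e) (near j y σj≡y))
    where open Feasible feasible

  Injection-swap : ∀ {F Fs i i⁻} → Injection I τ F Fs → ¬ DistSetLe I τ 2 (inj₁ i⁻) F →
    Injection I τ (F ∪ ⁅ i ⁆) ((Fs - i⁻) ∪ ⁅ i ⁆)
  Injection-swap {i = i} f i⁻-far =
    Injection-∪⁅⁆ (Injection-⊆ (p⊆p∪q ⁅ i ⁆) (Injection-─ f i⁻-far))
                  (x∈p∪q⁺ (inj₂ (x∈⁅x⁆ i))) DistLe-refl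

  far⇒InU : ∀ {F i} → InFτ I τ i → ¬ DistSetLe I τ 4 (inj₁ i) F → InU I τ F i
  far⇒InU i∈Fτ far = i∈Fτ , λ (x , x∈F , d) → far (x , x∈F , facility-DistLe-odd refl d)

  covered-or-far : ∀ F Fs → Covering I τ F Fs ⊎ ∃ λ i⁻ → i⁻ ∈ Fs × ¬ DistSetLe I τ 4 (inj₁ i⁻) F
  covered-or-far F Fs with any? (λ x → (x ∈? Fs) ×-dec ¬? (DistSetLe? 4 (inj₁ x) F))
  ... | yes far = inj₂ far
  ... | no none = inj₁ λ x x∈Fs →
    decidable-stable (DistSetLe? 4 (inj₁ x) F) (λ ¬d → none (x , x∈Fs , ¬d))

  assigned? : (σ : Assignment I τ) (x : Maybe (Fin nF)) → U.Decidable (λ j → σ j ≡ x)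
  assigned? σ x j = ≡-decᴹ _≟ᶠ_ (σ j) x

  neighbours-out-or-assigned : ∀ i (σ : Assignment I τ) →
    (∀ j → Edge I τ (inj₁ i) (inj₂ j) → σ j ≡ nothing) ⊎
    ∃₂ λ j y → Edge I τ (inj₁ i) (inj₂ j) × σ j ≡ just y
  neighbours-out-or-assigned i σ with any? (λ j → neighbour? i j ×-dec ¬? (assigned? σ nothing j))
  ... | no none = inj₁ λ j e →
    decidable-stable (assigned? σ nothing j) (λ σj≢nothing → none (j , e , σj≢nothing))
  ... | yes (j , e , σj≢nothing) with ≢nothing⇒just σj≢nothing
  ... | y , σj≡y = inj₂ (j , y , e , σj≡y)

  swap : Fin nF → Fin nF → Assignment I τ → Assignment I τ
  swap i i⁻ σ j with neighbour? i j | σ j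
  ... | yes _ | _      = just i
  ... | no _  | nothing = nothing
  ... | no _  | just y with y ≟ᶠ i⁻
  ...   | yes _ = nothing
  ...   | no _  = just y

  module _ (i i⁻ : Fin nF) (σ : Assignment I τ) where

    swap-neighbour : ∀ {j} → Edge I τ (inj₁ i) (inj₂ j) → swap i i⁻ σ j ≡ just i
    swap-neighbour {j} e with neighbour? i j
    ... | yes _ = refl
    ... | no ¬e = contradiction e ¬e

    swap-keep : ∀ {j y} → ¬ Edge I τ (inj₁ i) (inj₂ j) → σ j ≡ just y → y ≢ i⁻ →
      swap i i⁻ σ j ≡ just y
    swap-keep {j} {y} ¬e σj≡y y≢i⁻ with neighbour? i j
    ... | yes e = contradiction e ¬e
    ... | no _ rewrite σj≡y with y ≟ᶠ i⁻
    ...   | yes y≡i⁻ = contradiction y≡i⁻ y≢i⁻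
    ...   | no _     = refl

    swap-just : ∀ j {y} → swap i i⁻ σ j ≡ just y →
      (y ≡ i × Edge I τ (inj₁ i) (inj₂ j)) ⊎ (σ j ≡ just y × y ≢ i⁻)
    swap-just j with neighbour? i j | σ j
    ... | yes e | _       = λ { refl → inj₁ (refl , e) }
    ... | no _  | nothing = λ ()
    ... | no _  | just y with y ≟ᶠ i⁻
    ...   | yes _    = λ ()
    ...   | no y≢i⁻ = λ { refl → inj₂ (refl , y≢i⁻) }

    swap-nothing : ∀ j → swap i i⁻ σ j ≡ nothing →
      (σ j ≡ nothing × ¬ Edge I τ (inj₁ i) (inj₂ j)) ⊎ σ j ≡ just i⁻
    swap-nothing j with neighbour? i j | σ j
    ... | yes _ | _       = λ ()
    ... | no ¬e | nothing = λ _ → inj₁ (refl , ¬e)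
    ... | no _  | just y with y ≟ᶠ i⁻
    ...   | yes refl = λ _ → inj₂ refl
    ...   | no _     = λ ()

    swap-preimage-new : InFτ I τ i → L i ≤ preimageSize I τ (swap i i⁻ σ) (just i)
    swap-preimage-new i∈Fτ = begin
      L i
        ≤⟨ i∈Fτ ⟩
      ballSize I τ i
        ≤⟨ length-filter-mono (λ j → c I τ i j ≤ℚ? τ) (neighbour? i) (i∈Fτ ,_) (allFin nD) ⟩
      degF I τ i
        ≤⟨ length-filter-mono (neighbour? i) (assigned? (swap i i⁻ σ) (just i))
                              swap-neighbour (allFin nD) ⟩
      preimageSize I τ (swap i i⁻ σ) (just i) ∎
      where open ≤-Reasoning

    module _ (N⊆out : ∀ j → Edge I τ (inj₁ i) (inj₂ j) → σ j ≡ nothing) where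

      swap-preimage-kept : ∀ {y} → y ≢ i⁻ →
        preimageSize I τ σ (just y) ≤ preimageSize I τ (swap i i⁻ σ) (just y)
      swap-preimage-kept {y} y≢i⁻ =
        length-filter-mono (assigned? σ (just y)) (assigned? (swap i i⁻ σ) (just y))
                           kept (allFin nD)
        where
        kept : ∀ {j} → σ j ≡ just y → swap i i⁻ σ j ≡ just y
        kept {j} σj≡y =
          swap-keep (λ e → contradiction (trans (sym σj≡y) (N⊆out j e)) λ ()) σj≡y y≢i⁻

      swap-outliers : (∀ j → σ j ≡ just i⁻ → Edge I τ (inj₁ i⁻) (inj₂ j)) →
        degF I τ i⁻ ≤ degF I τ i →
        preimageSize I τ (swap i i⁻ σ) nothing ≤ preimageSize I τ σ nothing
      swap-outliers σ⁻¹i⁻⊆N deg≤ = begin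
        preimageSize I τ (swap i i⁻ σ) nothing
          ≤⟨ length-filter-⊆∪ (assigned? (swap i i⁻ σ) nothing) out∖N? (assigned? σ (just i⁻))
                               (swap-nothing _) js ⟩
        countD I τ out∖N? + preimageSize I τ σ (just i⁻)
          ≤⟨ +-monoʳ-≤ (countD I τ out∖N?)
               (length-filter-mono (assigned? σ (just i⁻)) (neighbour? i⁻) (σ⁻¹i⁻⊆N _) js) ⟩
        countD I τ out∖N? + degF I τ i⁻
          ≤⟨ +-monoʳ-≤ (countD I τ out∖N?) deg≤ ⟩
        countD I τ out∖N? + degF I τ i
          ≤⟨ +-monoʳ-≤ (countD I τ out∖N?)
               (length-filter-mono (neighbour? i) out∩N? (λ e → N⊆out _ e , e) js) ⟩
        countD I τ out∖N? + countD I τ out∩N?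
          ≡⟨ +-comm (countD I τ out∖N?) (countD I τ out∩N?) ⟩
        countD I τ out∩N? + countD I τ out∖N?
          ≡⟨ length-filter-split (assigned? σ nothing) (neighbour? i) js ⟨
        preimageSize I τ σ nothing ∎
        where
        open ≤-Reasoning
        js = allFin nD
        out∩N? = assigned? σ nothing ∩? neighbour? i
        out∖N? = assigned? σ nothing ∩? ∁? (neighbour? i)

      Feasible-swap : ∀ {Fs} → Feasible I τ Fs σ → i⁻ ∈ Fs → InFτ I τ i → degF I τ i⁻ ≤ degF I τ i →
        Feasible I τ ((Fs - i⁻) ∪ ⁅ i ⁆) (swap i i⁻ σ)
      Feasible-swap {Fs} feasible i⁻∈Fs i∈Fτ deg≤ = record
        { sub      = sub′
        ; card     = card′
        ; range    = range′
        ; lower    = lower′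
        ; outliers = ≤-trans (swap-outliers (λ j → DistLe1⇒Edge ∘ near j i⁻) deg≤) outliers
        ; near     = near′
        }
        where
        open Feasible feasible
        Fs′ = (Fs - i⁻) ∪ ⁅ i ⁆

        sub′ : SubFτ I τ Fs′
        sub′ y y∈Fs′ with x∈p∪⁅y⁆⁻ (Fs - i⁻) y∈Fs′
        ... | inj₁ y∈Fs-i⁻ = sub y (p─q⊆p Fs ⁅ i⁻ ⁆ y∈Fs-i⁻)
        ... | inj₂ refl    = i∈Fτ

        card′ : ∣ Fs′ ∣ ≤ k
        card′ = begin
          ∣ Fs′ ∣                  ≤⟨ ∣p∪q∣≤∣p∣+∣q∣ (Fs - i⁻) ⁅ i ⁆ ⟩
          ∣ Fs - i⁻ ∣ + ∣ ⁅ i ⁆ ∣ ≡⟨ cong (∣ Fs - i⁻ ∣ +_) (∣⁅x⁆∣≡1 i) ⟩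
          ∣ Fs - i⁻ ∣ + 1          ≡⟨ +-comm ∣ Fs - i⁻ ∣ 1 ⟩
          suc ∣ Fs - i⁻ ∣          ≤⟨ x∈p⇒∣p-x∣<∣p∣ i⁻∈Fs ⟩
          ∣ Fs ∣                   ≤⟨ card ⟩
          k                        ∎
          where open ≤-Reasoning

        range′ : ∀ j y → swap i i⁻ σ j ≡ just y → y ∈ Fs′
        range′ j y σ′j≡y with swap-just j σ′j≡y
        ... | inj₁ (refl , _)     = x∈p∪q⁺ (inj₂ (x∈⁅x⁆ i))
        ... | inj₂ (σj≡y , y≢i⁻) = x∈p∪q⁺ (inj₁ (x∈p∧x≢y⇒x∈p-y (range j y σj≡y) y≢i⁻))

        lower′ : ∀ y → y ∈ Fs′ → L y ≤ preimageSize I τ (swap i i⁻ σ) (just y)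
        lower′ y y∈Fs′ with x∈p∪⁅y⁆⁻ (Fs - i⁻) y∈Fs′
        ... | inj₁ y∈Fs-i⁻ = ≤-trans (lower y (p─q⊆p Fs ⁅ i⁻ ⁆ y∈Fs-i⁻))
                                     (swap-preimage-kept (x∈p-y⇒x≢y Fs y∈Fs-i⁻))
        ... | inj₂ refl    = swap-preimage-new i∈Fτ

        near′ : ∀ j y → swap i i⁻ σ j ≡ just y → DistLe I τ 1 (inj₂ j) (inj₁ y)
        near′ j y σ′j≡y with swap-just j σ′j≡y
        ... | inj₁ (refl , e)  = Edge⇒DistLe {inj₂ j} {inj₁ i} e
        ... | inj₂ (σj≡y , _) = near j y σj≡y

mainTheorem7 : (I : Instance) (τ : ℚ) → 0ℚ ≤ℚ τ →
    (F : Subset (Instance.nF I)) → PreSkeleton I τ F →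
    (i : Fin (Instance.nF I)) → InU I τ F i →
    (∀ i' → InU I τ F i' → degF I τ i' ≤ degF I τ i) →
    Skeleton I τ F ⊎ PreSkeleton I τ (F ∪ ⁅ i ⁆)
mainTheorem7 I τ _ F (sep , Fs , σ , feasible , f) i i∈U maximal
  with covered-or-far I τ F Fs
... | inj₁ covering = inj₁ (sep , Fs , σ , feasible , covering , f)
... | inj₂ (i⁻ , i⁻∈Fs , i⁻-far) with neighbours-out-or-assigned I τ i σ
...   | inj₂ (j , y , e , σj≡y) =
  inj₂ (Separation-∪⁅⁆ I τ sep i∈U , Fs , σ , feasible ,
        Injection-∪-assigned-neighbour I τ feasible f e σj≡y)
...   | inj₁ N⊆out =
  inj₂ (Separation-∪⁅⁆ I τ sep i∈U , (Fs - i⁻) ∪ ⁅ i ⁆ , swap I τ i i⁻ σ ,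
        Feasible-swap I τ i i⁻ σ N⊆out feasible i⁻∈Fs (proj₁ i∈U)
          (maximal i⁻ (far⇒InU I τ (Feasible.sub feasible i⁻ i⁻∈Fs) i⁻-far)) ,
        Injection-swap I τ f (i⁻-far ∘ Graph.DistSetLe-mono I τ (s≤s (s≤s z≤n))))
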